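{- Fix relation variables $R_1,\dots,R_n$ with schemas $\Gamma_1,\dots,\Gamma_n$. For every schema $\Gamma$ and every Datalog formula $T$ (over $R_1,\dots,R_n$) whose free term variables are contained in $\Gamma$, and for all $\mathcal R=(\mathcal R_1,\dots,\mathcal R_n)\in\prod_i\mathrm{Rel}_{\Gamma_i}$ and changes $\delta\mathcal R=(\delta\mathcal R_1,\dots,\delta\mathcal R_n)$ with $\delta\mathcal R_i=(P_i,Q_i)\in\mathrm{Rel}_{\Gamma_i}\bowtie\mathrm{Rel}_{\Gamma_i}$: the relations $[\![\Delta(T)]\!]_\Gamma(\mathcal R,\delta\mathcal R)$ and $[\![\nabla(T)]\!]_\Gamma(\mathcal R,\delta\mathcal R)$ are disjoint, and $$[\![T]\!]_\Gamma(\mathcal R_1\oplus_{\bowtie}\delta\mathcal R_1,\dots,\mathcal R_n\oplus_{\bowtie}\delta\mathcal R_n)=[\![T]\!]_\Gamma(\mathcal R)\oplus_{\bowtie}\big([\![\Delta(T)]\!]_\Gamma(\mathcal R,\delta\mathcal R),\ [\![\nabla(T)]\!]_\Gamma(\mathcal R,\delta\mathcal R)\big).$$ That is, $(\mathcal R,\delta\mathcal R)\mapsto([\![\Delta(T)]\!]_\Gamma,[\![\nabla(T)]\!]_\Gamma)$ is a derivative of $[\![T]\!]_\Gamma$ with respect to the change actions $\hat L_{\bowtie}$ (componentwise on the product).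
   Context: Boolean change action: for a Boolean algebra $L$, $L\bowtie L=\{(p,q)\mid p\wedge q=\bot\}$ and $a\oplus_{\bowtie}(p,q)=(a\vee p)\wedge\neg q$ (monoid operation $(p,q)\bowtie(r,s)=((p\wedge\neg s)\vee r,(q\wedge\neg r)\vee s)$, identity $(\bot,\bot)$); on a product of Boolean algebras changes and action are taken componentwise. Relations: a schema is a finite set of names; a named tuple over $\Gamma$ assigns a value to each name of $\Gamma$. For each schema $\Gamma$ a set $\mathcal U_\Gamma$ of named tuples over $\Gamma$ is fixed (closed-world universe), such that restricting a tuple of $\mathcal U_{\Gamma\cup\{x\}}$ to $\Gamma$ gives a tuple of $\mathcal U_\Gamma$. $\mathrm{Rel}_\Gamma$ is the set of subsets of $\mathcal U_\Gamma$, a complete Boolean algebra with $\neg R=\mathcal U_\Gamma\setminus R$. $\sigma_\Gamma$ restricts tuples (and sets of tuples) to the names in $\Gamma$. The names of each $\Gamma_j$ are listed in a fixed order. Formulae: $T::=\top\mid\bot\mid T\wedge T\mid T\vee T\mid\neg T\mid\exists x.T\mid R_j(x_1,\dots,x_k)$ with $k=|\Gamma_j|$ and $x_i$ term variables. Semantics $[\![T]\!]_\Gamma:\prod_i\mathrm{Rel}_{\Gamma_i}\to\mathrm{Rel}_\Gamma$ (free term variables of $T$ in $\Gamma$; bound variable $x$ of $\exists x.T$ assumed not in $\Gamma$): $[\![\top]\!]_\Gamma(\mathcal R)=\mathcal U_\Gamma$; $[\![\bot]\!]_\Gamma(\mathcal R)=\emptyset$; $\wedge,\vee,\neg$ are interpreted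 by $\cap,\cup$ and complement in $\mathcal U_\Gamma$; $[\![R_j(x_1,\dots,x_k)]\!]_\Gamma(\mathcal R)$ is the set of $u\in\mathcal U_\Gamma$ such that the $\Gamma_j$-tuple whose $i$-th name is assigned $u(x_i)$ lies in $\mathcal R_j$; $[\![\exists x.T]\!]_\Gamma(\mathcal R)=\sigma_\Gamma([\![T]\!]_{\Gamma\cup\{x\}}(\mathcal R))$. Derivative formulae: introduce fresh relation variables $\Delta R_i,\nabla R_i$ of schema $\Gamma_i$. Define mutually recursively: $\Delta(\bot)=\Delta(\top)=\bot$; $\Delta(R_j(\vec x))=\Delta R_j(\vec x)$; $\Delta(T\vee U)=\Delta(T)\vee\Delta(U)$; $\Delta(T\wedge U)=(\Delta(T)\wedge X(U))\vee(\Delta(U)\wedge X(T))$; $\Delta(\neg T)=\nabla(T)$; $\Delta(\exists x.T)=\exists x.\Delta(T)$; $\nabla(\bot)=\nabla(\top)=\bot$; $\nabla(R_j(\vec x))=\nabla R_j(\vec x)$; $\nabla(T\vee U)=(\nabla(T)\wedge\neg X(U))\vee(\nabla(U)\wedge\neg X(T))$; $\nabla(T\wedge U)=(\nabla(T)\wedge U)\vee(T\wedge\nabla(U))$; $\nabla(\neg T)=\Delta(T)$; $\nabla(\exists x.T)=\exists x.\nabla(T)\wedge\neg\exists x.X(T)$; and $X(T)=(T\vee\Delta(T))\wedge\neg\nabla(T)$. $[\![\Delta(T)]\!]_\Gamma(\mathcal R,\delta\mathcal R)$ denotes evaluation of $\Delta(T)$ with $R_i\mapsto\mathcal R_i$,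 $\Delta R_i\mapsto P_i$, $\nabla R_i\mapsto Q_i$ (similarly for $\nabla(T)$). -}

module Defs where

open import Level using (0ℓ)
open import Data.Empty using (⊥)
open import Data.Product using (Σ; _×_; _,_; proj₁; proj₂; Σ-syntax)
open import Data.Sum using (_⊎_; inj₁; inj₂)
open import Data.Fin using (Fin)
open import Data.List using (List; _∷_; length)
open import Data.List.Membership.Propositional using (_∈_; _∉_)
open import Data.List.Relation.Unary.Any using (here; there; index)
open import Data.List.Relation.Unary.All.Properties using (¬Any⇒All¬)
open import Data.List.Relation.Unary.Unique.Propositional using (Unique)
open import Data.List.Relation.Unary.AllPairs using (_∷_)
open import Relation.Nullary using (¬_)
open import Relation.Binary.PropositionalEquality using (_≡_; subst)
open import Function.Bundles using (_⇔_)

module Datalog (Name V : Set) where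

  -- Schemas: finite sets of names, represented as duplicate-free lists
  -- (the list order is the fixed order of the names of the schema).

  record Schema : Set where
    constructor schema
    field
      names  : List Name
      unique : Unique names
  open Schema public

  extend : (Γ : Schema) (x : Name) → x ∉ names Γ → Schema
  extend Γ x fr = schema (x ∷ names Γ) (¬Any⇒All¬ (names Γ) fr ∷ unique Γ)

  Tuple : Schema → Set
  Tuple Γ = (y : Name) → y ∈ names Γ → V

  restrict : (Γ : Schema) (x : Name) (fr : x ∉ names Γ) →
             Tuple (extend Γ x fr) → Tuple Γ
  restrict Γ x fr t y p = t y (there p)

  record Universe : Set₁ where
    field
      𝒰      : (Γ : Schema) → Tuple Γ → Set
      closed : (Γ : Schema) (x : Name) (fr : x ∉ names Γ) (t : Tuple (extend Γ x fr)) →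
               𝒰 (extend Γ x fr) t → 𝒰 Γ (restrict Γ x fr t)

  -- Syntax of formulae over relation variables indexed by I with schemas sch,
  -- intrinsically scoped: Formula sch Γ = formulae with free term variables in Γ.

  data Formula {I : Set} (sch : I → Schema) : Schema → Set where
    ⊤F ⊥F : ∀ {Γ} → Formula sch Γ
    _∧F_ _∨F_ : ∀ {Γ} → Formula sch Γ → Formula sch Γ → Formula sch Γ
    ¬F_ : ∀ {Γ} → Formula sch Γ → Formula sch Γ
    ∃F : ∀ {Γ} (x : Name) (fr : x ∉ names Γ) → Formula sch (extend Γ x fr) → Formula sch Γ
    -- R_j(x_1,…,x_k), k = |Γ_j|, each x_i a name of Γ
    atom : ∀ {Γ} (j : I) → (Fin (length (names (sch j))) → Σ[ x ∈ Name ] x ∈ names Γ) →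
           Formula sch Γ

  -- relation variables of derivative formulae: R_i, ΔR_i, ∇R_i
  data DVar (I : Set) : Set where
    base Δv ∇v : I → DVar I

  dsch : {I : Set} → (I → Schema) → DVar I → Schema
  dsch sch (base i) = sch i
  dsch sch (Δv i)   = sch i
  dsch sch (∇v i)   = sch i

  emb : ∀ {I} {sch : I → Schema} {Γ} → Formula sch Γ → Formula (dsch sch) Γ
  emb ⊤F = ⊤F
  emb ⊥F = ⊥F
  emb (T ∧F U) = emb T ∧F emb U
  emb (T ∨F U) = emb T ∨F emb U
  emb (¬F T) = ¬F emb T
  emb (∃F x fr T) = ∃F x fr (emb T)
  emb (atom j xs) = atom (base j) xs

  mutual
    Δ : ∀ {I} {sch : I → Schema} {Γ} → Formula sch Γ → Formula (dsch sch) Γ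
    Δ ⊤F = ⊥F
    Δ ⊥F = ⊥F
    Δ (atom j xs) = atom (Δv j) xs
    Δ (T ∨F U) = Δ T ∨F Δ U
    Δ (T ∧F U) = (Δ T ∧F X U) ∨F (Δ U ∧F X T)
    Δ (¬F T) = ∇ T
    Δ (∃F x fr T) = ∃F x fr (Δ T)

    ∇ : ∀ {I} {sch : I → Schema} {Γ} → Formula sch Γ → Formula (dsch sch) Γ
    ∇ ⊤F = ⊥F
    ∇ ⊥F = ⊥F
    ∇ (atom j xs) = atom (∇v j) xs
    ∇ (T ∨F U) = (∇ T ∧F (¬F X U)) ∨F (∇ U ∧F (¬F X T))
    ∇ (T ∧F U) = (∇ T ∧F emb U) ∨F (emb T ∧F ∇ U)
    ∇ (¬F T) = Δ T
    ∇ (∃F x fr T) = ∃F x fr (∇ T) ∧F (¬F ∃F x fr (X T))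

    X : ∀ {I} {sch : I → Schema} {Γ} → Formula sch Γ → Formula (dsch sch) Γ
    X T = (emb T ∨F Δ T) ∧F (¬F ∇ T)

  module Sem (U : Universe) where
    open Universe U

    record Rel (Γ : Schema) : Set₁ where
      constructor rel
      field
        mem : Tuple Γ → Set
        sub : ∀ t → mem t → 𝒰 Γ t
    open Rel public

    ⊤R : ∀ {Γ} → Rel Γ
    ⊤R {Γ} = rel (𝒰 Γ) (λ _ u → u)

    ⊥R : ∀ {Γ} → Rel Γ
    ⊥R = rel (λ _ → ⊥) (λ _ ())

    _∩_ : ∀ {Γ} → Rel Γ → Rel Γ → Rel Γ
    A ∩ B = rel (λ t → mem A t × mem B t) (λ t p → sub A t (proj₁ p))

    _∪_ : ∀ {Γ} → Rel Γ → Rel Γ → Rel Γ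
    A ∪ B = rel (λ t → mem A t ⊎ mem B t) sb
      where
      sb : ∀ t → (mem A t ⊎ mem B t) → _
      sb t (inj₁ a) = sub A t a
      sb t (inj₂ b) = sub B t b

    ∁ : ∀ {Γ} → Rel Γ → Rel Γ
    ∁ {Γ} A = rel (λ t → 𝒰 Γ t × ¬ mem A t) (λ t p → proj₁ p)

    _≐_ : ∀ {Γ} → Rel Γ → Rel Γ → Set
    A ≐ B = ∀ t → mem A t ⇔ mem B t

    Disjoint : ∀ {Γ} → Rel Γ → Rel Γ → Set
    Disjoint A B = ∀ t → mem A t → mem B t → ⊥

    record Change (Γ : Schema) : Set₁ where
      constructor change
      field
        pos neg : Rel Γ
        disj    : Disjoint pos neg
    open Change public

    _⊕_ : ∀ {Γ} → Rel Γ → Rel Γ × Rel Γ → Rel Γ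
    a ⊕ (p , q) = (a ∪ p) ∩ ∁ q

    ⟦_⟧ : ∀ {I} {sch : I → Schema} {Γ} → Formula sch Γ → ((i : I) → Rel (sch i)) → Rel Γ
    ⟦ ⊤F ⟧ ρ = ⊤R
    ⟦ ⊥F ⟧ ρ = ⊥R
    ⟦ T ∧F U ⟧ ρ = ⟦ T ⟧ ρ ∩ ⟦ U ⟧ ρ
    ⟦ T ∨F U ⟧ ρ = ⟦ T ⟧ ρ ∪ ⟦ U ⟧ ρ
    ⟦ ¬F T ⟧ ρ = ∁ (⟦ T ⟧ ρ)
    ⟦_⟧ {Γ = Γ} (∃F x fr T) ρ =
      rel (λ u → Σ[ w ∈ Tuple (extend Γ x fr) ] mem (⟦ T ⟧ ρ) w × restrict Γ x fr w ≡ u)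
          (λ { u (w , m , eq) → subst (𝒰 Γ) eq (closed Γ x fr w (sub (⟦ T ⟧ ρ) w m)) })
    ⟦_⟧ {sch = sch} {Γ = Γ} (atom j xs) ρ =
      rel (λ u → 𝒰 Γ u ×
                 mem (ρ j) (λ y p → u (proj₁ (xs (index p))) (proj₂ (xs (index p)))))
          (λ u p → proj₁ p)

    denv : ∀ {I} {sch : I → Schema} → ((i : I) → Rel (sch i)) → ((i : I) → Change (sch i)) →
           (v : DVar I) → Rel (dsch sch v)
    denv R δR (base i) = R i
    denv R δR (Δv i)   = pos (δR i)
    denv R δR (∇v i)   = neg (δR i)

-- A pair (p , q) of disjoint relations is a change from a to a′ when
-- a′ = (a ∪ p) ∖ q.  Changes propagate through every operation of the semantics:
-- from changes of a and b one obtains changes of a ∩ b, a ∪ b, ∁ a and of the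
-- projection σ a, built exactly as Δ and ∇ prescribe (X T denotes the updated value
-- of T), and reindexing tuples, which is all an atom does, commutes with changes.
-- Induction on T then shows that (⟦Δ T⟧, ⟦∇ T⟧) is a change from ⟦T⟧ to ⟦T⟧ of the
-- updated relations.  The rules for ∪, ∁ and σ are classical: the updated relation
-- is described by a complement, and deciding membership in it needs excluded middle.
module Submission where

open import Defs
open import Level using (0ℓ)
open import Data.Nat using (ℕ)
open import Data.Fin using (Fin)
open import Data.Product using (_×_; _,_; proj₁; Σ-syntax; map₂)
open import Data.Product.Function.NonDependent.Propositional using (_×-⇔_)
open import Data.Sum as Sum using (_⊎_; inj₁; inj₂)
open import Data.Sum.Function.Propositional using (_⊎-⇔_)
open import Data.List.Membership.Propositional using (_∉_)
open import Data.Empty using (⊥; ⊥-elim)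
open import Relation.Nullary using (¬_; yes; no)
open import Relation.Binary.PropositionalEquality using (_≡_; subst)
open import Function.Bundles using (mk⇔; Equivalence)
open import Function.Related.TypeIsomorphisms using (¬-cong-⇔)
import Function.Properties.Equivalence as ⇔
open import Axiom.ExcludedMiddle using (ExcludedMiddle)

module Changes {Name V : Set} (U : Datalog.Universe Name V) where
  open Datalog Name V
  open Universe U
  open Sem U
  open Equivalence using (to; from)

  variable
    Γ Γ′ : Schema

  infix 4 _≈_

  -- _≐_ unfolds to a statement about `mem` alone, from which Agda cannot recover the
  -- relations; wrapped in a record it determines them and they can be inferred.
  record _≈_ (a b : Rel Γ) : Set where
    constructor elementwise
    field pointwise : a ≐ b
  open _≈_

  infix 4 _⊆_

  _⊆_ : Rel Γ → Rel Γ → Set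
  a ⊆ b = ∀ t → mem a t → mem b t

  ⊆-antisym : {a b : Rel Γ} → a ⊆ b → b ⊆ a → a ≈ b
  ⊆-antisym a⊆b b⊆a = elementwise λ t → mk⇔ (a⊆b t) (b⊆a t)

  ≈-refl : {a : Rel Γ} → a ≈ a
  ≈-refl = elementwise λ t → ⇔.refl

  ≈-trans : {a b c : Rel Γ} → a ≈ b → b ≈ c → a ≈ c
  ≈-trans (elementwise a≐b) (elementwise b≐c) = elementwise λ t → ⇔.trans (a≐b t) (b≐c t)

  ∩-cong : {a a′ b b′ : Rel Γ} → a ≈ a′ → b ≈ b′ → a ∩ b ≈ a′ ∩ b′
  ∩-cong (elementwise a≐) (elementwise b≐) = elementwise λ t → a≐ t ×-⇔ b≐ t

  ∪-cong : {a a′ b b′ : Rel Γ} → a ≈ a′ → b ≈ b′ → a ∪ b ≈ a′ ∪ b′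
  ∪-cong (elementwise a≐) (elementwise b≐) = elementwise λ t → a≐ t ⊎-⇔ b≐ t

  ∁-cong : {a a′ : Rel Γ} → a ≈ a′ → ∁ a ≈ ∁ a′
  ∁-cong (elementwise a≐) = elementwise λ t → ⇔.refl ×-⇔ ¬-cong-⇔ (a≐ t)

  ⊕-congˡ : {a a′ p q : Rel Γ} → a ≈ a′ → a ⊕ (p , q) ≈ a′ ⊕ (p , q)
  ⊕-congˡ {q = q} a≈ = ∩-cong (∪-cong a≈ ≈-refl) (≈-refl {a = ∁ q})

  -- σ a has the membership predicate of ⟦ ∃F x fr T ⟧ but its own proof of `sub`, so
  -- the two agree only up to re-packing record fields that mention `mem` alone.
  σ : {x : Name} {fr : x ∉ names Γ} → Rel (extend Γ x fr) → Rel Γ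
  σ {Γ} {x} {fr} a =
    rel (λ u → Σ[ w ∈ Tuple (extend Γ x fr) ] mem a w × restrict Γ x fr w ≡ u)
        (λ u (w , m , eq) → subst (𝒰 Γ) eq (closed Γ x fr w (sub a w m)))

  σ-cong : {x : Name} {fr : x ∉ names Γ} {a a′ : Rel (extend Γ x fr)} →
           a ≈ a′ → σ a ≈ σ a′
  σ-cong (elementwise a≐) = elementwise λ t →
    mk⇔ (map₂ (λ (m , eq) → to (a≐ _) m , eq)) (map₂ (λ (m , eq) → from (a≐ _) m , eq))

  -- ⟦ atom j xs ⟧ ρ is the preimage of ρ j under the substitution xs.
  reindex : (Tuple Γ → Tuple Γ′) → Rel Γ′ → Rel Γ
  reindex {Γ} f a = rel (λ u → 𝒰 Γ u × mem a (f u)) (λ u m → proj₁ m)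

  reindex-cong : (f : Tuple Γ → Tuple Γ′) {a a′ : Rel Γ′} → a ≈ a′ → reindex {Γ} f a ≈ reindex f a′
  reindex-cong f (elementwise a≐) = elementwise λ t → ⇔.refl ×-⇔ a≐ (f t)

  ⟦emb⟧ : ∀ {I} {sch : I → Schema} (ρ : (v : DVar I) → Rel (dsch sch v))
          (T : Formula sch Γ) → ⟦ emb T ⟧ ρ ≈ ⟦ T ⟧ (λ i → ρ (base i))
  ⟦emb⟧ ρ ⊤F = ≈-refl
  ⟦emb⟧ ρ ⊥F = ≈-refl
  ⟦emb⟧ ρ (T ∧F U) = ∩-cong (⟦emb⟧ ρ T) (⟦emb⟧ ρ U)
  ⟦emb⟧ ρ (T ∨F U) = ∪-cong (⟦emb⟧ ρ T) (⟦emb⟧ ρ U)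
  ⟦emb⟧ ρ (¬F T) = ∁-cong (⟦emb⟧ ρ T)
  ⟦emb⟧ ρ (∃F x fr T) = elementwise (pointwise (σ-cong (⟦emb⟧ ρ T)))
  ⟦emb⟧ ρ (atom j xs) = ≈-refl

  record IsChange (a p q a′ : Rel Γ) : Set where
    field
      disjoint : Disjoint p q
      update   : a′ ≈ a ⊕ (p , q)
  open IsChange

  pos⊆⊕ : {a p q a′ : Rel Γ} → IsChange a p q a′ → p ⊆ a ⊕ (p , q)
  pos⊆⊕ {p = p} δa t p∈ = inj₂ p∈ , sub p t p∈ , disjoint δa t p∈

  ⊤-change : IsChange (⊤R {Γ}) ⊥R ⊥R ⊤R
  ⊤-change = record
    { disjoint = λ t ()
    ; update   = ⊆-antisym (λ t u → inj₁ u , u , λ ()) λ { t (inj₁ u , _) → u ; t (inj₂ () , _) } }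

  ⊥-change : IsChange (⊥R {Γ}) ⊥R ⊥R ⊥R
  ⊥-change = record
    { disjoint = λ t ()
    ; update   = ⊆-antisym (λ t ()) λ { t (inj₁ () , _) ; t (inj₂ () , _) } }

  reindex-change : {a p q a′ : Rel Γ′} (f : Tuple Γ → Tuple Γ′) → IsChange a p q a′ →
                   IsChange (reindex {Γ} f a) (reindex f p) (reindex f q) (reindex f a′)
  reindex-change {a = a} {p} {q} f δa = record
    { disjoint = λ t (_ , p∈) (_ , q∈) → disjoint δa _ p∈ q∈
    ; update   = ≈-trans (reindex-cong f (update δa)) (⊆-antisym forth back) }
    where
    forth : reindex f (a ⊕ (p , q)) ⊆ reindex f a ⊕ (reindex f p , reindex f q)
    forth t (u , inj₁ a∈ , _ , q∉) = inj₁ (u , a∈) , u , λ (_ , q∈) → q∉ q∈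
    forth t (u , inj₂ p∈ , _ , q∉) = inj₂ (u , p∈) , u , λ (_ , q∈) → q∉ q∈
    back : reindex f a ⊕ (reindex f p , reindex f q) ⊆ reindex f (a ⊕ (p , q))
    back t (inj₁ (u , a∈) , _ , q∉) = u , inj₁ a∈ , sub a _ a∈ , λ q∈ → q∉ (u , q∈)
    back t (inj₂ (u , p∈) , _ , q∉) = u , inj₂ p∈ , sub p _ p∈ , λ q∈ → q∉ (u , q∈)

  ∩-change : {a p q a′ b r s b′ : Rel Γ} → IsChange a p q a′ → IsChange b r s b′ →
             IsChange (a ∩ b) ((p ∩ (b ⊕ (r , s))) ∪ (r ∩ (a ⊕ (p , q))))
                              ((q ∩ b) ∪ (a ∩ s)) (a′ ∩ b′)
  ∩-change {Γ} {a} {p} {q} {_} {b} {r} {s} δa δb = record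
    { disjoint = P#Q
    ; update   = ≈-trans (∩-cong (update δa) (update δb)) (⊆-antisym forth back) }
    where
    P Q : Rel Γ
    P = (p ∩ (b ⊕ (r , s))) ∪ (r ∩ (a ⊕ (p , q)))
    Q = (q ∩ b) ∪ (a ∩ s)
    P#Q : Disjoint P Q
    P#Q t (inj₁ (p∈ , _))         (inj₁ (q∈ , _)) = disjoint δa t p∈ q∈
    P#Q t (inj₁ (_ , _ , _ , s∉)) (inj₂ (_ , s∈)) = s∉ s∈
    P#Q t (inj₂ (_ , _ , _ , q∉)) (inj₁ (q∈ , _)) = q∉ q∈
    P#Q t (inj₂ (r∈ , _))         (inj₂ (_ , s∈)) = disjoint δb t r∈ s∈
    forth : (a ⊕ (p , q)) ∩ (b ⊕ (r , s)) ⊆ (a ∩ b) ⊕ (P , Q)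
    forth t (a⊕∈@(x , u , q∉) , b⊕∈@(y , _ , s∉)) = added x y , u , removed
      where
      added : mem a t ⊎ mem p t → mem b t ⊎ mem r t → mem ((a ∩ b) ∪ P) t
      added (inj₂ p∈) _         = inj₂ (inj₁ (p∈ , b⊕∈))
      added _         (inj₂ r∈) = inj₂ (inj₂ (r∈ , a⊕∈))
      added (inj₁ a∈) (inj₁ b∈) = inj₁ (a∈ , b∈)
      removed : ¬ mem Q t
      removed (inj₁ (q∈ , _)) = q∉ q∈
      removed (inj₂ (_ , s∈)) = s∉ s∈
    back : (a ∩ b) ⊕ (P , Q) ⊆ (a ⊕ (p , q)) ∩ (b ⊕ (r , s))
    back t (inj₁ (a∈ , b∈) , u , Q∉) =
      (inj₁ a∈ , u , λ q∈ → Q∉ (inj₁ (q∈ , b∈))) , (inj₁ b∈ , u , λ s∈ → Q∉ (inj₂ (a∈ , s∈)))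
    back t (inj₂ (inj₁ (p∈ , b⊕∈)) , _) = pos⊆⊕ δa t p∈ , b⊕∈
    back t (inj₂ (inj₂ (r∈ , a⊕∈)) , _) = a⊕∈ , pos⊆⊕ δb t r∈

  module _ (em : ExcludedMiddle 0ℓ) where

    ∪-change : {a p q a′ b r s b′ : Rel Γ} → IsChange a p q a′ → IsChange b r s b′ →
               IsChange (a ∪ b) (p ∪ r) ((q ∩ ∁ (b ⊕ (r , s))) ∪ (s ∩ ∁ (a ⊕ (p , q)))) (a′ ∪ b′)
    ∪-change {Γ} {a} {p} {q} {_} {b} {r} {s} δa δb = record
      { disjoint = P#Q
      ; update   = ≈-trans (∪-cong (update δa) (update δb)) (⊆-antisym forth back) }
      where
      Q : Rel Γ
      Q = (q ∩ ∁ (b ⊕ (r , s))) ∪ (s ∩ ∁ (a ⊕ (p , q)))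
      P#Q : Disjoint (p ∪ r) Q
      P#Q t (inj₁ p∈) (inj₁ (q∈ , _))      = disjoint δa t p∈ q∈
      P#Q t (inj₁ p∈) (inj₂ (_ , _ , a⊕∉)) = a⊕∉ (pos⊆⊕ δa t p∈)
      P#Q t (inj₂ r∈) (inj₁ (_ , _ , b⊕∉)) = b⊕∉ (pos⊆⊕ δb t r∈)
      P#Q t (inj₂ r∈) (inj₂ (s∈ , _))      = disjoint δb t r∈ s∈
      forth : (a ⊕ (p , q)) ∪ (b ⊕ (r , s)) ⊆ (a ∪ b) ⊕ (p ∪ r , Q)
      forth t (inj₁ a⊕∈@(x , u , q∉)) = Sum.map inj₁ inj₁ x , u , removed
        where
        removed : ¬ mem Q t
        removed (inj₁ (q∈ , _))      = q∉ q∈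
        removed (inj₂ (_ , _ , a⊕∉)) = a⊕∉ a⊕∈
      forth t (inj₂ b⊕∈@(y , u , s∉)) = Sum.map inj₂ inj₂ y , u , removed
        where
        removed : ¬ mem Q t
        removed (inj₁ (_ , _ , b⊕∉)) = b⊕∉ b⊕∈
        removed (inj₂ (s∈ , _))      = s∉ s∈
      back : (a ∪ b) ⊕ (p ∪ r , Q) ⊆ (a ⊕ (p , q)) ∪ (b ⊕ (r , s))
      back t (x , u , Q∉) with em {mem (a ⊕ (p , q)) t} | em {mem (b ⊕ (r , s)) t}
      ... | yes a⊕∈ | _        = inj₁ a⊕∈
      ... | no _    | yes b⊕∈  = inj₂ b⊕∈
      ... | no a⊕∉  | no b⊕∉   = ⊥-elim (absent x)
        where
        q∉ : ¬ mem q t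
        q∉ q∈ = Q∉ (inj₁ (q∈ , u , b⊕∉))
        s∉ : ¬ mem s t
        s∉ s∈ = Q∉ (inj₂ (s∈ , u , a⊕∉))
        absent : mem (a ∪ b) t ⊎ mem (p ∪ r) t → ⊥
        absent (inj₁ (inj₁ a∈)) = a⊕∉ (inj₁ a∈ , u , q∉)
        absent (inj₁ (inj₂ b∈)) = b⊕∉ (inj₁ b∈ , u , s∉)
        absent (inj₂ (inj₁ p∈)) = a⊕∉ (inj₂ p∈ , u , q∉)
        absent (inj₂ (inj₂ r∈)) = b⊕∉ (inj₂ r∈ , u , s∉)

    ∁-change : {a p q a′ : Rel Γ} → IsChange a p q a′ → IsChange (∁ a) q p (∁ a′)
    ∁-change {a = a} {p} {q} δa = record
      { disjoint = λ t q∈ p∈ → disjoint δa t p∈ q∈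
      ; update   = ≈-trans (∁-cong (update δa)) (⊆-antisym forth back) }
      where
      forth : ∁ (a ⊕ (p , q)) ⊆ ∁ a ⊕ (q , p)
      forth t (u , a⊕∉) with em {mem q t}
      ... | yes q∈ = inj₂ q∈ , u , λ p∈ → disjoint δa t p∈ q∈
      ... | no q∉  = inj₁ (u , λ a∈ → a⊕∉ (inj₁ a∈ , u , q∉)) , u , λ p∈ → a⊕∉ (inj₂ p∈ , u , q∉)
      back : ∁ a ⊕ (q , p) ⊆ ∁ (a ⊕ (p , q))
      back t (x , u , p∉) = u , excluded x
        where
        excluded : mem (∁ a) t ⊎ mem q t → ¬ mem (a ⊕ (p , q)) t
        excluded (inj₂ q∈)      (_ , _ , q∉) = q∉ q∈
        excluded (inj₁ (_ , a∉)) (inj₁ a∈ , _) = a∉ a∈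
        excluded (inj₁ _)        (inj₂ p∈ , _) = p∉ p∈

    σ-change : {x : Name} {fr : x ∉ names Γ} {a p q a′ : Rel (extend Γ x fr)} → IsChange a p q a′ →
               IsChange (σ a) (σ p) (σ q ∩ ∁ (σ (a ⊕ (p , q)))) (σ a′)
    σ-change {a = a} {p} {q} δa = record
      { disjoint = λ t (w , p∈ , eq) (_ , _ , σ⊕∉) → σ⊕∉ (w , pos⊆⊕ δa w p∈ , eq)
      ; update   = ≈-trans (σ-cong (update δa)) (⊆-antisym forth back) }
      where
      forth : σ (a ⊕ (p , q)) ⊆ σ a ⊕ (σ p , σ q ∩ ∁ (σ (a ⊕ (p , q))))
      forth t σ⊕∈@(w , (y , _) , eq) =
        Sum.map (λ a∈ → w , a∈ , eq) (λ p∈ → w , p∈ , eq) y ,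
        sub (σ (a ⊕ (p , q))) t σ⊕∈ , λ (_ , _ , σ⊕∉) → σ⊕∉ σ⊕∈
      back : σ a ⊕ (σ p , σ q ∩ ∁ (σ (a ⊕ (p , q)))) ⊆ σ (a ⊕ (p , q))
      back t (y , u , Q∉) with em {mem (σ (a ⊕ (p , q))) t}
      ... | yes σ⊕∈ = σ⊕∈
      ... | no σ⊕∉  = ⊥-elim (absent y)
        where
        absent : mem (σ a) t ⊎ mem (σ p) t → ⊥
        absent (inj₂ (w , p∈ , eq)) = σ⊕∉ (w , pos⊆⊕ δa w p∈ , eq)
        absent (inj₁ (w , a∈ , eq)) with em {mem q w}
        ... | yes q∈ = Q∉ ((w , q∈ , eq) , u , σ⊕∉)
        ... | no q∉  = σ⊕∉ (w , (inj₁ a∈ , sub a w a∈ , q∉) , eq)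

    module _ {I : Set} {sch : I → Schema}
             (R : (i : I) → Rel (sch i)) (δR : (i : I) → Change (sch i)) where

      relation-change : (i : I) →
                        IsChange (R i) (pos (δR i)) (neg (δR i)) (R i ⊕ (pos (δR i) , neg (δR i)))
      relation-change i = record { disjoint = disj (δR i) ; update = ≈-refl }

      Δ∇-change : (T : Formula sch Γ) →
                   IsChange (⟦ emb T ⟧ (denv R δR)) (⟦ Δ T ⟧ (denv R δR)) (⟦ ∇ T ⟧ (denv R δR))
                            (⟦ T ⟧ (λ i → R i ⊕ (pos (δR i) , neg (δR i))))
      Δ∇-change ⊤F          = ⊤-change
      Δ∇-change ⊥F          = ⊥-change
      Δ∇-change (T ∧F U)    = ∩-change (Δ∇-change T) (Δ∇-change U)
      Δ∇-change (T ∨F U)    = ∪-change (Δ∇-change T) (Δ∇-change U)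
      Δ∇-change (¬F T)      = ∁-change (Δ∇-change T)
      Δ∇-change (∃F x fr T) = record { IsChange (σ-change (Δ∇-change T)) }
      Δ∇-change (atom j xs) = reindex-change _ (relation-change j)

mainTheorem11 : ExcludedMiddle 0ℓ →
    (Name V : Set) → let open Datalog Name V in
    (U : Universe) → let open Sem U in
    {n : ℕ} (Γs : Fin n → Schema) (Γ : Schema) (T : Formula Γs Γ)
    (R : (i : Fin n) → Rel (Γs i)) (δR : (i : Fin n) → Change (Γs i)) →
    Disjoint (⟦ Δ T ⟧ (denv R δR)) (⟦ ∇ T ⟧ (denv R δR))
    × (⟦ T ⟧ (λ i → R i ⊕ (pos (δR i) , neg (δR i)))
       ≐ (⟦ T ⟧ R ⊕ (⟦ Δ T ⟧ (denv R δR) , ⟦ ∇ T ⟧ (denv R δR))))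
mainTheorem11 em Name V U Γs Γ T R δR = disjoint , _≈_.pointwise updated
  where
  open Datalog Name V
  open Sem U
  open Changes U
  open IsChange (Δ∇-change em R δR T)
  updated : ⟦ T ⟧ (λ i → R i ⊕ (pos (δR i) , neg (δR i)))
            ≈ ⟦ T ⟧ R ⊕ (⟦ Δ T ⟧ (denv R δR) , ⟦ ∇ T ⟧ (denv R δR))
  updated = ≈-trans update (⊕-congˡ {q = ⟦ ∇ T ⟧ (denv R δR)} (⟦emb⟧ (denv R δR) T))
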